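{- Let $G$ be a connected $(P_3+P_2)$-free graph and let $x,y$ be adjacent vertices of $G$. Let $G_{xy}=G-\{x,y\}$, let $A_{xy}$ be the set of vertices of $G_{xy}$ adjacent to $x$ or to $y$, and $B_{xy}=V(G_{xy})\setminus A_{xy}$. Assume every vertex of $B_{xy}$ has a neighbor in $A_{xy}$. Let $\gamma'(G_{xy})$ be the minimum cardinality of a subset of $V(G_{xy})$ dominating $B_{xy}$, let $\gamma''(G_{xy})$ be the minimum cardinality of a subset of $A_{xy}$ dominating $B_{xy}$, and let $k_{xy}$ be the number of connected components of $G[B_{xy}]$. If $\gamma(G)\ge 4$, then $\gamma'(G_{xy})=\min(\gamma''(G_{xy}),k_{xy})$.
   Context: $P_3+P_2$ is the disjoint union of a path on 3 vertices and a path on 2 vertices; "$H$-free" means having no induced subgraph isomorphic to $H$. A set $V'$ dominates a set $V''$ if every vertex of $V''\setminus V'$ has a neighbor in $V'$. $\gamma(G)$ is the minimum size of a set dominating $V(G)$. $G[U]$ is the subgraph induced by $U$. -}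

module Defs where

open import Data.Nat using (ℕ; _≤_; _⊓_)
open import Data.Bool using (Bool; true; false)
open import Data.Fin using (Fin; zero; suc)
open import Data.Fin.Subset using (Subset; _∈_; _∉_; ∣_∣)
open import Data.Product using (Σ; ∃; ∃-syntax; _×_; _,_)
open import Data.Sum using (_⊎_)
open import Data.Unit using (⊤)
open import Relation.Nullary using (¬_)
open import Relation.Binary.PropositionalEquality using (_≡_; _≢_)
open import Function.Definitions using (Injective)
open import Function.Bundles using (_⇔_)

record Graph : Set where
  field
    n      : ℕ
    adj    : Fin n → Fin n → Bool
    sym    : ∀ u v → adj u v ≡ adj v u
    irrefl : ∀ v → adj v v ≡ false

module _ (G : Graph) where
  open Graph G

  V : Set
  V = Fin n

  E : V → V → Set
  E u v = adj u v ≡ true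

  -- walks all of whose vertices satisfy P (walks in the induced subgraph G[P])
  data WalkIn (P : V → Set) : V → V → Set where
    here : ∀ {u} → P u → WalkIn P u u
    step : ∀ {u w v} → P u → E u w → WalkIn P w v → WalkIn P u v

  Connected : Set
  Connected = ∀ u v → WalkIn (λ _ → ⊤) u v

  Dominates : Subset n → (V → Set) → Set
  Dominates S T = ∀ v → T v → v ∉ S → ∃[ u ] (u ∈ S × E u v)

  IsMinCard : (Subset n → Set) → ℕ → Set
  IsMinCard Q k = (∃[ S ] (Q S × ∣ S ∣ ≡ k)) × (∀ S → Q S → k ≤ ∣ S ∣)

  IsDominationNumber : ℕ → Set
  IsDominationNumber g = IsMinCard (λ S → Dominates S (λ _ → ⊤)) g

  -- c is the number of connected components of G[P]:
  -- a surjective labelling of P-vertices by Fin c whose fibres are exactly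
  -- the connectivity classes of G[P].
  NumComponents : (V → Set) → ℕ → Set
  NumComponents P c =
    Σ ((v : V) → P v → Fin c) λ f →
      (∀ i → ∃[ v ] Σ (P v) λ p → f v p ≡ i) ×
      (∀ u v (pu : P u) (pv : P v) → (f u pu ≡ f v pv) ⇔ WalkIn P u v)

  Free : {m : ℕ} → (Fin m → Fin m → Bool) → Set
  Free {m} H = ¬ (Σ (Fin m → V) λ f → Injective _≡_ _≡_ f × (∀ i j → adj (f i) (f j) ≡ H i j))

  InA : V → V → V → Set
  InA x y v = v ≢ x × v ≢ y × (E v x ⊎ E v y)

  InB : V → V → V → Set
  InB x y v = v ≢ x × v ≢ y × ¬ (E v x ⊎ E v y)

  InGxy : V → V → Subset n → Set
  InGxy x y S = x ∉ S × y ∉ S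

-- P3 + P2 on Fin 5: path 0-1-2 and edge 3-4
P3+P2 : Fin 5 → Fin 5 → Bool
P3+P2 zero (suc zero) = true
P3+P2 (suc zero) zero = true
P3+P2 (suc zero) (suc (suc zero)) = true
P3+P2 (suc (suc zero)) (suc zero) = true
P3+P2 (suc (suc (suc zero))) (suc (suc (suc (suc zero)))) = true
P3+P2 (suc (suc (suc (suc zero)))) (suc (suc (suc zero))) = true
P3+P2 _ _ = false

module Submission where

-- We show γ' = min(γ'', k).
--
-- 1. Every induced P3 in G[B] plus the edge xy is an induced P3+P2, so each
--    component of G[B] is a clique (B-walk⇒close).
-- 2. γ' ≤ γ'' trivially, and γ' ≤ k since one vertex per component
--    dominates B (γ'≤k).
-- 3. If a set S dominating B has fewer than k vertices, some component C
--    contains none of them; a vertex u of C is dominated by some t ∈ S ∩ A.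
--    For v ∈ S ∩ B, t misses at most one vertex m of the clique N[v] ∩ B
--    (otherwise u–t–x/y and two missed vertices form a P3+P2), so v can be
--    exchanged for t or for an A-neighbour of m (Step.exchanged).  Doing this
--    for every v (move-into-A) gives a dominating set inside A, whence
--    γ'' ≤ γ' when γ' < k (γ''≤γ').

open import Defs
open import Data.Nat using (ℕ; _≤_; _⊓_)
open import Data.Fin using (Fin)
open import Data.Fin.Subset using (Subset; _∈_; ∣_∣)
open import Data.Product using (∃-syntax; _×_)
open import Relation.Binary.PropositionalEquality using (_≡_)

open import Data.Nat using (zero; suc; _<_; _+_; z≤n; s≤s)
open import Data.Nat.Properties
  using (≤-refl; ≤-trans; ≤-reflexive; ≤-<-trans; ≤-antisym; ≮⇒≥; _<?_; +-suc; +-comm;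
         +-monoʳ-≤; n≤1+n; <⇒≱; ⊓-glb; m⊓n≤m; m⊓n≤n; module ≤-Reasoning)
open import Data.Bool using (true; false)
import Data.Bool as Bool
open import Data.Bool.Properties using (¬-not)
open import Data.Fin using (zero; suc; _≟_)
open import Data.Fin.Properties using (suc-injective; 0≢1+n; all?; any?; ¬∀⟶∃¬)
open import Data.Fin.Subset using (_∉_; _∪_; _─_; _-_; ⁅_⁆; inside; outside)
  renaming (⊥ to ∅)
open import Data.Fin.Subset.Properties
  using (_∈?_; x∉⁅y⁆⇒x≢y; x∈p∧x≢y⇒x∈p-y; x∈p⇒∣p-x∣<∣p∣; ∣⁅x⁆∣≡1; ∣⊥∣≡0; x∈⁅x⁆;
         x∈⁅y⁆⇒x≡y; x∈p∪q⁺; x∈p∪q⁻; ∉⊥; p─q⊆p)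
open import Data.Vec using ([]; _∷_; here; there)
open import Data.List using (List; []; _∷_; allFin)
open import Data.List.Relation.Unary.Any using (here; there)
open import Data.List.Membership.Propositional using () renaming (_∈_ to _∈ˡ_)
open import Data.List.Membership.Propositional.Properties using (∈-allFin)
open import Data.Product using (Σ; _,_; proj₁; proj₂)
open import Data.Sum using (_⊎_; inj₁; inj₂; [_,_])
open import Data.Unit using (tt)
open import Data.Empty using (⊥; ⊥-elim)
open import Function using (_∘_; id)
open import Function.Bundles using (Equivalence)
open import Function.Definitions using (Injective)
open import Relation.Nullary using (¬_; Dec; yes; no; ¬?; contradiction)
open import Relation.Nullary.Decidable using (toWitness; _⊎-dec_; _×-dec_; _→-dec_)
open import Relation.Binary.PropositionalEquality using (_≢_; refl; sym; trans; cong; subst)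

x∈p─q⇒x∉q : ∀ {n} {x : Fin n} (p q : Subset n) → x ∈ p ─ q → x ∉ q
x∈p─q⇒x∉q (inside  ∷ p) (inside ∷ q) () here
x∈p─q⇒x∉q (outside ∷ p) (inside ∷ q) () here
x∈p─q⇒x∉q (_ ∷ p) (_ ∷ q) (there x∈p─q) (there x∈q) = x∈p─q⇒x∉q p q x∈p─q x∈q

x∈p-y⇒x≢y : ∀ {n} {x y : Fin n} (p : Subset n) → x ∈ p - y → x ≢ y
x∈p-y⇒x≢y {y = y} p x∈p-y = x∉⁅y⁆⇒x≢y (x∈p─q⇒x∉q p ⁅ y ⁆ x∈p-y)

∣p∪q∣≤∣p∣+∣q∣ : ∀ {n} (p q : Subset n) → ∣ p ∪ q ∣ ≤ ∣ p ∣ + ∣ q ∣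
∣p∪q∣≤∣p∣+∣q∣ []            []            = z≤n
∣p∪q∣≤∣p∣+∣q∣ (inside  ∷ p) (outside ∷ q) = s≤s (∣p∪q∣≤∣p∣+∣q∣ p q)
∣p∪q∣≤∣p∣+∣q∣ (inside  ∷ p) (inside  ∷ q) =
  s≤s (≤-trans (∣p∪q∣≤∣p∣+∣q∣ p q) (+-monoʳ-≤ ∣ p ∣ (n≤1+n ∣ q ∣)))
∣p∪q∣≤∣p∣+∣q∣ (outside ∷ p) (inside  ∷ q) =
  ≤-trans (s≤s (∣p∪q∣≤∣p∣+∣q∣ p q)) (≤-reflexive (sym (+-suc ∣ p ∣ ∣ q ∣)))
∣p∪q∣≤∣p∣+∣q∣ (outside ∷ p) (outside ∷ q) = ∣p∪q∣≤∣p∣+∣q∣ p q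

exchange : ∀ {n} → Subset n → Fin n → Fin n → Subset n
exchange p x y = (p - x) ∪ ⁅ y ⁆

∣exchange∣≤∣p∣ : ∀ {n} {p : Subset n} {x} (y : Fin n) → x ∈ p → ∣ exchange p x y ∣ ≤ ∣ p ∣
∣exchange∣≤∣p∣ {p = p} {x} y x∈p = begin
  ∣ (p - x) ∪ ⁅ y ⁆ ∣     ≤⟨ ∣p∪q∣≤∣p∣+∣q∣ (p - x) ⁅ y ⁆ ⟩
  ∣ p - x ∣ + ∣ ⁅ y ⁆ ∣   ≡⟨ cong (∣ p - x ∣ +_) (∣⁅x⁆∣≡1 y) ⟩
  ∣ p - x ∣ + 1          ≡⟨ +-comm ∣ p - x ∣ 1 ⟩
  suc ∣ p - x ∣          ≤⟨ x∈p⇒∣p-x∣<∣p∣ x∈p ⟩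
  ∣ p ∣                  ∎
  where open ≤-Reasoning

∈exchange⁻ : ∀ {n} {p : Subset n} {x y z} → z ∈ exchange p x y → z ≡ y ⊎ (z ∈ p × z ≢ x)
∈exchange⁻ {p = p} {x} {y} z∈ with x∈p∪q⁻ (p - x) ⁅ y ⁆ z∈
... | inj₁ z∈p-x = inj₂ (p─q⊆p p ⁅ x ⁆ z∈p-x , x∈p-y⇒x≢y p z∈p-x)
... | inj₂ z∈⁅y⁆ = inj₁ (x∈⁅y⁆⇒x≡y y z∈⁅y⁆)

new∈exchange : ∀ {n} (p : Subset n) x y → y ∈ exchange p x y
new∈exchange p x y = x∈p∪q⁺ (inj₂ (x∈⁅x⁆ y))

old∈exchange : ∀ {n} {p : Subset n} {x z} (y : Fin n) → z ∈ p → z ≢ x → z ∈ exchange p x y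
old∈exchange y z∈p z≢x = x∈p∪q⁺ (inj₁ (x∈p∧x≢y⇒x∈p-y z∈p z≢x))

exchange-avoids : ∀ {n} {p : Subset n} {x y z} → z ∉ p → z ≢ y → z ∉ exchange p x y
exchange-avoids z∉p z≢y z∈ with ∈exchange⁻ z∈
... | inj₁ z≡y       = z≢y z≡y
... | inj₂ (z∈p , _) = z∉p z∈p

injection⇒≤∣p∣ : ∀ {n c} (p : Subset n) (f : Fin c → Fin n) →
  Injective _≡_ _≡_ f → (∀ i → f i ∈ p) → c ≤ ∣ p ∣
injection⇒≤∣p∣ {c = zero}  p f f-inj f∈p = z≤n
injection⇒≤∣p∣ {c = suc c} p f f-inj f∈p =
  ≤-trans (s≤s (injection⇒≤∣p∣ (p - f zero) (f ∘ suc) (suc-injective ∘ f-inj) rest∈p-f₀))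
          (x∈p⇒∣p-x∣<∣p∣ (f∈p zero))
  where
  rest∈p-f₀ : ∀ i → f (suc i) ∈ p - f zero
  rest∈p-f₀ i = x∈p∧x≢y⇒x∈p-y (f∈p (suc i)) (0≢1+n ∘ sym ∘ f-inj)

image : ∀ {n c} → (Fin c → Fin n) → Subset n
image {c = zero}  r = ∅
image {c = suc c} r = ⁅ r zero ⁆ ∪ image (r ∘ suc)

∣image∣≤c : ∀ {n c} (r : Fin c → Fin n) → ∣ image r ∣ ≤ c
∣image∣≤c {n} {zero}  r = ≤-reflexive (∣⊥∣≡0 n)
∣image∣≤c {n} {suc c} r = begin
  ∣ ⁅ r zero ⁆ ∪ image (r ∘ suc) ∣      ≤⟨ ∣p∪q∣≤∣p∣+∣q∣ ⁅ r zero ⁆ (image (r ∘ suc)) ⟩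
  ∣ ⁅ r zero ⁆ ∣ + ∣ image (r ∘ suc) ∣  ≡⟨ cong (_+ ∣ image (r ∘ suc) ∣) (∣⁅x⁆∣≡1 (r zero)) ⟩
  suc ∣ image (r ∘ suc) ∣              ≤⟨ s≤s (∣image∣≤c (r ∘ suc)) ⟩
  suc c                               ∎
  where open ≤-Reasoning

∈image⁺ : ∀ {n c} (r : Fin c → Fin n) i → r i ∈ image r
∈image⁺ r zero    = x∈p∪q⁺ (inj₁ (x∈⁅x⁆ (r zero)))
∈image⁺ r (suc i) = x∈p∪q⁺ (inj₂ (∈image⁺ (r ∘ suc) i))

∈image⁻ : ∀ {n c} (r : Fin c → Fin n) {z} → z ∈ image r → ∃[ i ] r i ≡ z
∈image⁻ {c = zero}  r z∈ = contradiction z∈ ∉⊥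
∈image⁻ {c = suc c} r z∈ with x∈p∪q⁻ ⁅ r zero ⁆ (image (r ∘ suc)) z∈
... | inj₁ z∈⁅r₀⁆ = zero , sym (x∈⁅y⁆⇒x≡y (r zero) z∈⁅r₀⁆)
... | inj₂ z∈rest with ∈image⁻ (r ∘ suc) z∈rest
...   | i , rᵢ≡z = suc i , rᵢ≡z

P3+P2-twins : ∀ i j → (∀ k → P3+P2 i k ≡ P3+P2 j k) →
  i ≡ j ⊎ (i ≡ zero × j ≡ suc (suc zero)) ⊎ (i ≡ suc (suc zero) × j ≡ zero)
P3+P2-twins = toWitness {a? = all? λ i → all? λ j →
  all? (λ k → P3+P2 i k Bool.≟ P3+P2 j k) →-dec
    (i ≟ j ⊎-dec (i ≟ zero ×-dec j ≟ suc (suc zero)) ⊎-dec (i ≟ suc (suc zero) ×-dec j ≟ zero))} tt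

module GraphBasics (G : Graph) where
  open Graph G using (n; adj; irrefl)

  E-sym : ∀ {u v} → E G u v → E G v u
  E-sym {u} {v} uv = trans (Graph.sym G v u) uv

  E? : ∀ u v → Dec (E G u v)
  E? u v = adj u v Bool.≟ true

  walk-start : ∀ {P u v} → WalkIn G P u v → P u
  walk-start (here Pu)     = Pu
  walk-start (step Pu _ _) = Pu

  walk-end : ∀ {P u v} → WalkIn G P u v → P v
  walk-end (here Pv)       = Pv
  walk-end (step _ _ walk) = walk-end walk

  exchange-dominates : ∀ {S T v d} → Dominates G S T →
    (∀ w → T w → w ≡ v ⊎ E G v w → ∃[ d′ ] (d′ ∈ exchange S v d × E G d′ w)) →
    Dominates G (exchange S v d) T
  exchange-dominates {S} {T} {v} {d} dom cover w Tw w∉S′ with w ∈? S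
  ... | yes w∈S with w ≟ v
  ...   | yes w≡v = cover w Tw (inj₁ w≡v)
  ...   | no w≢v  = contradiction (old∈exchange d w∈S w≢v) w∉S′
  exchange-dominates {S} {T} {v} {d} dom cover w Tw w∉S′ | no w∉S with dom w Tw w∉S
  ... | d′ , d′∈S , d′w with d′ ≟ v
  ...   | yes refl = cover w Tw (inj₂ d′w)
  ...   | no d′≢v  = d′ , old∈exchange d d′∈S d′≢v , d′w

  no-induced-P3+P2 : Free G P3+P2 → ∀ {p₀ p₁ p₂ q₀ q₁} → p₀ ≢ p₂ →
    E G p₀ p₁ → E G p₁ p₂ → ¬ E G p₀ p₂ → E G q₀ q₁ →
    ¬ E G p₀ q₀ → ¬ E G p₀ q₁ → ¬ E G p₁ q₀ → ¬ E G p₁ q₁ → ¬ E G p₂ q₀ → ¬ E G p₂ q₁ → ⊥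
  no-induced-P3+P2 free {p₀} {p₁} {p₂} {q₀} {q₁} p₀≢p₂ e01 e12 n02 e34 n03 n04 n13 n14 n23 n24 =
    free (f , f-injective , f-induced)
    where
    f : Fin 5 → Fin n
    f zero                          = p₀
    f (suc zero)                    = p₁
    f (suc (suc zero))              = p₂
    f (suc (suc (suc zero)))        = q₀
    f (suc (suc (suc (suc zero))))  = q₁

    non : ∀ {u v} → ¬ E G u v → adj u v ≡ false
    non = ¬-not

    rev : ∀ {u v b} → adj u v ≡ b → adj v u ≡ b
    rev {u} {v} uv = trans (Graph.sym G v u) uv

    f-induced : ∀ i j → adj (f i) (f j) ≡ P3+P2 i j
    f-induced zero                   zero                   = irrefl p₀
    f-induced zero                   (suc zero)             = e01
    f-induced zero                   (suc (suc zero))       = non n02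
    f-induced zero                   (suc (suc (suc zero))) = non n03
    f-induced zero                   (suc (suc (suc (suc zero)))) = non n04
    f-induced (suc zero)             zero                   = rev e01
    f-induced (suc zero)             (suc zero)             = irrefl p₁
    f-induced (suc zero)             (suc (suc zero))       = e12
    f-induced (suc zero)             (suc (suc (suc zero))) = non n13
    f-induced (suc zero)             (suc (suc (suc (suc zero)))) = non n14
    f-induced (suc (suc zero))       zero                   = rev (non n02)
    f-induced (suc (suc zero))       (suc zero)             = rev e12
    f-induced (suc (suc zero))       (suc (suc zero))       = irrefl p₂
    f-induced (suc (suc zero))       (suc (suc (suc zero))) = non n23
    f-induced (suc (suc zero))       (suc (suc (suc (suc zero)))) = non n24
    f-induced (suc (suc (suc zero))) zero                   = rev (non n03)
    f-induced (suc (suc (suc zero))) (suc zero)             = rev (non n13)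
    f-induced (suc (suc (suc zero))) (suc (suc zero))       = rev (non n23)
    f-induced (suc (suc (suc zero))) (suc (suc (suc zero))) = irrefl q₀
    f-induced (suc (suc (suc zero))) (suc (suc (suc (suc zero)))) = e34
    f-induced (suc (suc (suc (suc zero)))) zero                   = rev (non n04)
    f-induced (suc (suc (suc (suc zero)))) (suc zero)             = rev (non n14)
    f-induced (suc (suc (suc (suc zero)))) (suc (suc zero))       = rev (non n24)
    f-induced (suc (suc (suc (suc zero)))) (suc (suc (suc zero))) = rev e34
    f-induced (suc (suc (suc (suc zero)))) (suc (suc (suc (suc zero)))) = irrefl q₁

    -- equal images have equal rows in P3+P2, so they are equal or the two path ends
    f-injective : Injective _≡_ _≡_ f
    f-injective {i} {j} fi≡fj with P3+P2-twins i j same-row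
      where
      same-row : ∀ k → P3+P2 i k ≡ P3+P2 j k
      same-row k = trans (sym (f-induced i k)) (trans (cong (λ z → adj z (f k)) fi≡fj) (f-induced j k))
    ... | inj₁ i≡j                  = i≡j
    ... | inj₂ (inj₁ (refl , refl)) = contradiction fi≡fj p₀≢p₂
    ... | inj₂ (inj₂ (refl , refl)) = contradiction (sym fi≡fj) p₀≢p₂

module EdgeSplit (G : Graph) (free : Free G P3+P2) {x y : Fin (Graph.n G)} (xy : E G x y) where
  open Graph G using (n)
  open GraphBasics G

  A B : Fin n → Set
  A = InA G x y
  B = InB G x y

  DomB-in-Gxy DomB-in-A : Subset n → Set
  DomB-in-Gxy S = InGxy G x y S × Dominates G S B
  DomB-in-A   S = (∀ v → v ∈ S → A v) × Dominates G S B

  B-¬x : ∀ {w} → B w → ¬ E G w x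
  B-¬x (_ , _ , far) wx = far (inj₁ wx)

  B-¬y : ∀ {w} → B w → ¬ E G w y
  B-¬y (_ , _ , far) wy = far (inj₂ wy)

  A⊎B : ∀ {u} → u ≢ x → u ≢ y → A u ⊎ B u
  A⊎B {u} u≢x u≢y with E? u x | E? u y
  ... | yes ux | _      = inj₁ (u≢x , u≢y , inj₁ ux)
  ... | no _   | yes uy = inj₁ (u≢x , u≢y , inj₂ uy)
  ... | no ¬ux | no ¬uy = inj₂ (u≢x , u≢y , [ ¬ux , ¬uy ])

  B? : ∀ u → Dec (B u)
  B? u with u ≟ x | u ≟ y
  ... | yes u≡x | _       = no λ (u≢x , _) → u≢x u≡x
  ... | no _    | yes u≡y = no λ (_ , u≢y , _) → u≢y u≡y
  ... | no u≢x  | no u≢y  with A⊎B u≢x u≢y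
  ...   | inj₁ (_ , _ , near) = no λ (_ , _ , far) → far near
  ...   | inj₂ Bu             = yes Bu

  -- G[B] has no induced P3: an induced path u–w–v in B together with the
  -- edge xy, which has no neighbour in B, would be an induced P3+P2.
  B-no-P3 : ∀ {u w v} → B u → B w → B v → E G u w → E G w v → u ≡ v ⊎ E G u v
  B-no-P3 {u} {w} {v} Bu Bw Bv uw wv with u ≟ v | E? u v
  ... | yes u≡v | _      = inj₁ u≡v
  ... | no _    | yes uv = inj₂ uv
  ... | no u≢v  | no ¬uv =
    ⊥-elim (no-induced-P3+P2 free u≢v uw wv ¬uv xy
              (B-¬x Bu) (B-¬y Bu) (B-¬x Bw) (B-¬y Bw) (B-¬x Bv) (B-¬y Bv))

  B-walk⇒close : ∀ {u v} → WalkIn G B u v → u ≡ v ⊎ E G u v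
  B-walk⇒close (here _) = inj₁ refl
  B-walk⇒close (step Bu uw walk) with B-walk⇒close walk
  ... | inj₁ refl = inj₂ uw
  ... | inj₂ wv   = B-no-P3 Bu (walk-start walk) (walk-end walk) uw wv

  γ'≤γ'' : ∀ {a b} → IsMinCard G DomB-in-Gxy a → IsMinCard G DomB-in-A b → a ≤ b
  γ'≤γ'' (_ , a-min) ((S , (S⊆A , S-dom) , ∣S∣≡b) , _) =
    subst (_ ≤_) ∣S∣≡b (a-min S (S-avoids , S-dom))
    where
    S-avoids : InGxy G x y S
    S-avoids = (λ x∈S → proj₁ (S⊆A x x∈S) refl) , (λ y∈S → proj₁ (proj₂ (S⊆A y y∈S)) refl)

  module Components {k : ℕ} (components : NumComponents G B k) where

    label : ∀ v → B v → Fin k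
    label = proj₁ components

    rep : Fin k → Fin n
    rep i = proj₁ (proj₁ (proj₂ components) i)

    rep-B : ∀ i → B (rep i)
    rep-B i = proj₁ (proj₂ (proj₁ (proj₂ components) i))

    rep-label : ∀ i → label (rep i) (rep-B i) ≡ i
    rep-label i = proj₂ (proj₂ (proj₁ (proj₂ components) i))

    close⇒same : ∀ {u v} (Bu : B u) (Bv : B v) → u ≡ v ⊎ E G u v → label u Bu ≡ label v Bv
    close⇒same {u} {v} Bu Bv u~v = Equivalence.from (proj₂ (proj₂ components) u v Bu Bv) (walk u~v)
      where
      walk : u ≡ v ⊎ E G u v → WalkIn G B u v
      walk (inj₁ refl) = here Bu
      walk (inj₂ uv)   = step Bu uv (here Bv)

    same⇒close : ∀ {u v} (Bu : B u) (Bv : B v) → label u Bu ≡ label v Bv → u ≡ v ⊎ E G u v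
    same⇒close {u} {v} Bu Bv same = B-walk⇒close (Equivalence.to (proj₂ (proj₂ components) u v Bu Bv) same)

    -- γ' ≤ k: the representatives avoid x, y and dominate B, as components are cliques
    γ'≤k : ∀ {a} → IsMinCard G DomB-in-Gxy a → a ≤ k
    γ'≤k (_ , a-min) = ≤-trans (a-min (image rep) (reps-avoid , reps-dominate)) (∣image∣≤c rep)
      where
      reps-in-B : ∀ {z} → z ∈ image rep → B z
      reps-in-B z∈ with ∈image⁻ rep z∈
      ... | i , refl = rep-B i

      reps-avoid : InGxy G x y (image rep)
      reps-avoid = (λ x∈ → proj₁ (reps-in-B x∈) refl) , (λ y∈ → proj₁ (proj₂ (reps-in-B y∈)) refl)

      reps-dominate : Dominates G (image rep) B
      reps-dominate w Bw w∉ with same⇒close (rep-B (label w Bw)) Bw (rep-label (label w Bw))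
      ... | inj₁ rep≡w = contradiction (subst (_∈ image rep) rep≡w (∈image⁺ rep (label w Bw))) w∉
      ... | inj₂ edge  = rep (label w Bw) , ∈image⁺ rep (label w Bw) , edge

    Meets : Subset n → Fin k → Set
    Meets S i = ∃[ w ] (w ∈ S × Σ (B w) λ Bw → label w Bw ≡ i)

    Meets? : ∀ S i → Dec (Meets S i)
    Meets? S i = any? λ w → w ∈? S ×-dec labelled? w
      where
      labelled? : ∀ w → Dec (Σ (B w) λ Bw → label w Bw ≡ i)
      labelled? w with B? w
      ... | no ¬Bw = no (¬Bw ∘ proj₁)
      ... | yes Bw with label w Bw ≟ i
      ...   | yes lw≡i = yes (Bw , lw≡i)
      ...   | no lw≢i  = no λ (Bw′ , lw≡i) → lw≢i (trans (close⇒same Bw Bw′ (inj₁ refl)) lw≡i)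

    missed-component : ∀ {S} → ∣ S ∣ < k → ∃[ i ] ¬ Meets S i
    missed-component {S} ∣S∣<k = ¬∀⟶∃¬ k (Meets S) (Meets? S) meets-all⇒k≤∣S∣
      where
      meets-all⇒k≤∣S∣ : ¬ (∀ i → Meets S i)
      meets-all⇒k≤∣S∣ meets = <⇒≱ ∣S∣<k (injection⇒≤∣p∣ S witness witness-injective (proj₁ ∘ proj₂ ∘ meets))
        where
        witness : Fin k → Fin n
        witness = proj₁ ∘ meets
        witness-injective : Injective _≡_ _≡_ witness
        witness-injective {i} {j} same with meets i | meets j
        ... | w , _ , Bw , lw≡i | w′ , _ , Bw′ , lw′≡j =
          trans (sym lw≡i) (trans (close⇒same Bw Bw′ (inj₁ same)) lw′≡j)

    module Exchange (A-neighbour : ∀ v → B v → ∃[ u ] (A u × E G u v)) where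
      module Step {S v} (good : DomB-in-Gxy S) (∣S∣<k : ∣ S ∣ < k) (v∈S : v ∈ S) (Bv : B v) where
        x∉S : x ∉ S
        x∉S = proj₁ (proj₁ good)

        y∉S : y ∉ S
        y∉S = proj₂ (proj₁ good)

        S-dom : Dominates G S B
        S-dom = proj₂ good

        i : Fin k
        i = proj₁ (missed-component {S} ∣S∣<k)

        unmet : ¬ Meets S i
        unmet = proj₂ (missed-component {S} ∣S∣<k)

        u : Fin n
        u = rep i

        Bu : B u
        Bu = rep-B i

        u∉S : u ∉ S
        u∉S u∈S = unmet (u , u∈S , Bu , rep-label i)

        t : Fin n
        t = proj₁ (S-dom u Bu u∉S)

        t∈S : t ∈ S
        t∈S = proj₁ (proj₂ (S-dom u Bu u∉S))

        tu : E G t u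
        tu = proj₂ (proj₂ (S-dom u Bu u∉S))

        -- t is not in B, as it would lie in the missed component of u
        t∈A : A t
        t∈A with A⊎B (λ t≡x → x∉S (subst (_∈ S) t≡x t∈S)) (λ t≡y → y∉S (subst (_∈ S) t≡y t∈S))
        ... | inj₁ At = At
        ... | inj₂ Bt = ⊥-elim (unmet (t , t∈S , Bt , trans (close⇒same Bt Bu (inj₂ tu)) (rep-label i)))

        t≢v : t ≢ v
        t≢v refl = proj₂ (proj₂ Bv) (proj₂ (proj₂ t∈A))

        -- the B-vertices of the closed neighbourhood of v: the component of v
        Near : Fin n → Set
        Near w = B w × (w ≡ v ⊎ E G v w)

        near-label : ∀ {w} (Nw : Near w) → label w (proj₁ Nw) ≡ label v Bv
        near-label (Bw , inj₁ w≡v) = close⇒same Bw Bv (inj₁ w≡v)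
        near-label (Bw , inj₂ vw)  = close⇒same Bw Bv (inj₂ (E-sym vw))

        near-clique : ∀ {w m} → Near w → Near m → w ≢ m → E G w m
        near-clique Nw Nm w≢m with same⇒close (proj₁ Nw) (proj₁ Nm) (trans (near-label Nw) (sym (near-label Nm)))
        ... | inj₁ w≡m = contradiction w≡m w≢m
        ... | inj₂ wm  = wm

        u-far : ∀ {w} → Near w → ¬ (u ≡ w ⊎ E G u w)
        u-far Nw u~w = unmet (v , v∈S , Bv ,
          trans (sym (near-label Nw)) (trans (sym (close⇒same Bu (proj₁ Nw) u~w)) (rep-label i)))

        anchor : ∃[ z ] (E G t z × (∀ {w} → B w → w ≢ z × ¬ E G w z))
        anchor with proj₂ (proj₂ t∈A)
        ... | inj₁ tx = x , tx , λ Bw → proj₁ Bw , B-¬x Bw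
        ... | inj₂ ty = y , ty , λ Bw → proj₁ (proj₂ Bw) , B-¬y Bw

        -- t misses at most one vertex of the component of v: two missed vertices
        -- w, m would form with the induced path u–t–z an induced P3+P2
        t-misses-at-most-one : ∀ {w m} → Near w → Near m → w ≢ m → E G t w ⊎ E G t m
        t-misses-at-most-one {w} {m} Nw Nm w≢m with E? t w | E? t m | anchor
        ... | yes tw | _      | _ = inj₁ tw
        ... | no _   | yes tm | _ = inj₂ tm
        ... | no ¬tw | no ¬tm | z , tz , B-far-z =
          ⊥-elim (no-induced-P3+P2 free (proj₁ (B-far-z Bu)) (E-sym tu) tz (proj₂ (B-far-z Bu))
                    (near-clique Nw Nm w≢m) (u-far Nw ∘ inj₂) (u-far Nm ∘ inj₂) ¬tw ¬tm
                    (proj₂ (B-far-z (proj₁ Nw)) ∘ E-sym) (proj₂ (B-far-z (proj₁ Nm)) ∘ E-sym))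

        -- a vertex of A which, together with t, dominates the component of v:
        -- the A-neighbour of the vertex missed by t if there is one, else t
        replacement : ∃[ d ] (A d × (∀ w → Near w → E G d w ⊎ E G t w))
        replacement with any? (λ m → (B? m ×-dec (m ≟ v ⊎-dec E? v m)) ×-dec ¬? (E? t m))
        ... | yes (m , Nm , ¬tm) with A-neighbour m (proj₁ Nm)
        ...   | s , As , sm = s , As , cover
          where
          cover : ∀ w → Near w → E G s w ⊎ E G t w
          cover w Nw with w ≟ m
          ... | yes refl = inj₁ sm
          ... | no w≢m   = inj₂ ([ id , (λ tm → contradiction tm ¬tm) ] (t-misses-at-most-one Nw Nm w≢m))
        replacement | no none = t , t∈A , cover
          where
          cover : ∀ w → Near w → E G t w ⊎ E G t w
          cover w Nw with E? t w
          ... | yes tw = inj₁ tw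
          ... | no ¬tw = ⊥-elim (none (w , Nw , ¬tw))

        exchanged : ∃[ d ] (A d × DomB-in-Gxy (exchange S v d))
        exchanged with replacement
        ... | d , Ad , cover = d , Ad , avoids , exchange-dominates S-dom cover′
          where
          avoids : InGxy G x y (exchange S v d)
          avoids = exchange-avoids x∉S (λ x≡d → proj₁ Ad (sym x≡d)) ,
                   exchange-avoids y∉S (λ y≡d → proj₁ (proj₂ Ad) (sym y≡d))
          cover′ : ∀ w → B w → w ≡ v ⊎ E G v w → ∃[ d′ ] (d′ ∈ exchange S v d × E G d′ w)
          cover′ w Bw w~v with cover w (Bw , w~v)
          ... | inj₁ dw = d , new∈exchange S v d , dw
          ... | inj₂ tw = t , old∈exchange d t∈S t≢v , tw

      -- a vertex of S that is not in B lies in A, so it is no longer pending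
      settle : ∀ {S v L} → InGxy G x y S → ¬ (v ∈ S × B v) →
        (∀ {d} → d ∈ S → A d ⊎ d ∈ˡ v ∷ L) → ∀ {d} → d ∈ S → A d ⊎ d ∈ˡ L
      settle {S} (x∉S , y∉S) ¬v∈S∩B pending d∈S with pending d∈S
      ... | inj₁ Ad          = inj₁ Ad
      ... | inj₂ (there d∈L) = inj₂ d∈L
      ... | inj₂ (here refl) with A⊎B (λ d≡x → x∉S (subst (_∈ S) d≡x d∈S)) (λ d≡y → y∉S (subst (_∈ S) d≡y d∈S))
      ...   | inj₁ Ad = inj₁ Ad
      ...   | inj₂ Bd = ⊥-elim (¬v∈S∩B (d∈S , Bd))

      -- A set S ⊆ V(G_xy) dominating B with fewer than k elements can be moved
      -- into A without growing: exchange its B-members one by one, where the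
      -- list L contains all members of S not yet known to lie in A.
      move-into-A : ∀ (L : List (Fin n)) {S} → DomB-in-Gxy S → ∣ S ∣ < k →
        (∀ {d} → d ∈ S → A d ⊎ d ∈ˡ L) → ∃[ S′ ] (DomB-in-A S′ × ∣ S′ ∣ ≤ ∣ S ∣)
      move-into-A [] {S} good _ pending =
        S , ((λ d d∈S → [ id , (λ ()) ] (pending d∈S)) , proj₂ good) , ≤-refl
      move-into-A (v ∷ L) {S} good ∣S∣<k pending with v ∈? S | B? v
      ... | no v∉S  | _      = move-into-A L good ∣S∣<k (settle (proj₁ good) (v∉S ∘ proj₁) pending)
      ... | yes _   | no ¬Bv = move-into-A L good ∣S∣<k (settle (proj₁ good) (¬Bv ∘ proj₂) pending)
      ... | yes v∈S | yes Bv with Step.exchanged good ∣S∣<k v∈S Bv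
      ...   | d , Ad , good′ with move-into-A L good′ (≤-<-trans shrinks ∣S∣<k) pending′
        where
        shrinks : ∣ exchange S v d ∣ ≤ ∣ S ∣
        shrinks = ∣exchange∣≤∣p∣ d v∈S
        pending′ : ∀ {d′} → d′ ∈ exchange S v d → A d′ ⊎ d′ ∈ˡ L
        pending′ d′∈ with ∈exchange⁻ d′∈
        ... | inj₁ refl = inj₁ Ad
        ... | inj₂ (d′∈S , d′≢v) with pending d′∈S
        ...   | inj₁ Ad′          = inj₁ Ad′
        ...   | inj₂ (here d′≡v)  = contradiction d′≡v d′≢v
        ...   | inj₂ (there d′∈L) = inj₂ d′∈L
      ...     | S′ , good-S′ , ∣S′∣≤ = S′ , good-S′ , ≤-trans ∣S′∣≤ (∣exchange∣≤∣p∣ d v∈S)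

      γ''≤γ' : ∀ {a b} → IsMinCard G DomB-in-Gxy a → IsMinCard G DomB-in-A b → a < k → b ≤ a
      γ''≤γ' ((S , good , ∣S∣≡a) , _) (_ , b-min) a<k
        with move-into-A (allFin n) good (subst (_< k) (sym ∣S∣≡a) a<k) (λ {d} _ → inj₂ (∈-allFin d))
      ... | S′ , S′-good , ∣S′∣≤∣S∣ = ≤-trans (b-min S′ S′-good) (subst (∣ S′ ∣ ≤_) ∣S∣≡a ∣S′∣≤∣S∣)

min-by-cases : ∀ {a b c} → a ≤ b → a ≤ c → (a < c → b ≤ a) → a ≡ b ⊓ c
min-by-cases {a} {b} {c} a≤b a≤c b≤a-if-a<c = ≤-antisym (⊓-glb a≤b a≤c) b⊓c≤a
  where
  b⊓c≤a : b ⊓ c ≤ a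
  b⊓c≤a with a <? c
  ... | yes a<c = ≤-trans (m⊓n≤m b c) (b≤a-if-a<c a<c)
  ... | no a≮c  = ≤-trans (m⊓n≤n b c) (≮⇒≥ a≮c)

lemma1 : (G : Graph) → Connected G → Free G P3+P2 →
    (x y : Fin (Graph.n G)) → E G x y →
    (∀ v → InB G x y v → ∃[ u ] (InA G x y u × E G u v)) →
    (∀ g → IsDominationNumber G g → 4 ≤ g) →
    (a b c : ℕ) →
    IsMinCard G (λ S → InGxy G x y S × Dominates G S (InB G x y)) a →
    IsMinCard G (λ S → (∀ v → v ∈ S → InA G x y v) × Dominates G S (InB G x y)) b →
    NumComponents G (InB G x y) c →
    a ≡ b ⊓ c
lemma1 G _ free _ _ xy A-neighbour _ _ _ _ γ′ γ″ components =
  min-by-cases (γ'≤γ'' γ′ γ″) (γ'≤k γ′) (γ''≤γ' γ′ γ″)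
  where
  open EdgeSplit G free xy
  open Components components
  open Exchange A-neighbour
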